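{- For every integer $n\ge 2$, there is a CNF formula that encodes the independent-set property of $\mathcal{I}_n$ and has at most $26\,n^2\log_2 n$ clauses.
   Context: For $n\ge 2$, $\mathcal{I}_n$ is the graph whose vertices are all integer intervals $[i,j]$ with $1\le i<j\le n$, with an edge between two distinct intervals whenever they intersect. For a formula $F$ and an assignment $\tau$ to some of its variables, $F|_\tau$ is obtained by deleting every clause satisfied by $\tau$ and deleting from the remaining clauses every literal falsified by $\tau$. Given a graph $G=(V,E)$, variables $X=\{x_v : v\in V\}$ and a (possibly empty) set $Y$ of auxiliary variables, a formula $F$ with variable set $X\cup Y$ encodes the independent-set property of $G$ if for every assignment $\tau: X\to\{\bot,\top\}$, $F|_\tau$ is satisfiable if and only if $\{v\in V : \tau(x_v)=\top\}$ is an independent set of $G$. -}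

module Defs where

open import Data.Nat using (ℕ; _≤_; _<_; _*_; _^_)
open import Data.Bool using (Bool; true; false; not; _∨_)
open import Data.Fin using (Fin)
open import Data.List using (List; []; _∷_; any; length)
open import Data.List.Relation.Unary.All using (All)
open import Data.List.Relation.Unary.Any using (Any)
open import Data.Sum using (_⊎_; inj₁; inj₂)
open import Data.Product using (Σ; ∃; _×_)
open import Relation.Binary.PropositionalEquality using (_≡_; _≢_)
open import Relation.Nullary using (¬_)
open import Level using (0ℓ) renaming (suc to lsuc)

record Graph : Set₁ where
  field
    Vertex : Set
    Adj    : Vertex → Vertex → Set

record Interval (n : ℕ) : Set where
  constructor [_,_]⟨_,_,_⟩
  field
    lo      : ℕ
    hi      : ℕ
    1≤lo    : 1 ≤ lo
    lo<hi   : lo < hi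
    hi≤n    : hi ≤ n
open Interval public

-- [i,j] and [k,l] intersect iff they share an integer point, i.e. i ≤ l and k ≤ j.
Intersect : ∀ {n} → Interval n → Interval n → Set
Intersect u v = (lo u ≤ hi v) × (lo v ≤ hi u)

𝓘 : ℕ → Graph
𝓘 n = record { Vertex = Interval n ; Adj = λ u v → (u ≢ v) × Intersect u v }

IsIndependent : (G : Graph) → (Graph.Vertex G → Bool) → Set
IsIndependent G S = ∀ u v → S u ≡ true → S v ≡ true → ¬ Graph.Adj G u v

data Literal (V : Set) : Set where
  pos : V → Literal V
  neg : V → Literal V

Clause : Set → Set
Clause V = List (Literal V)

CNF : Set → Set
CNF V = List (Clause V)

litVal : ∀ {V} → (V → Bool) → Literal V → Bool
litVal σ (pos x) = σ x
litVal σ (neg x) = not (σ x)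

Satisfies : ∀ {V} → (V → Bool) → CNF V → Set
Satisfies σ F = All (λ C → Any (λ l → litVal σ l ≡ true) C) F

Satisfiable : ∀ {V} → CNF V → Set
Satisfiable {V} F = ∃ λ (σ : V → Bool) → Satisfies σ F

-- Restriction F|τ of a formula over X ⊎ Y by an assignment τ to X:
-- delete clauses satisfied by τ, and delete literals falsified by τ.
-- The result is a formula over Y only.
data LitStatus (Y : Set) : Set where
  satisfied : LitStatus Y
  falsified : LitStatus Y
  remains   : Literal Y → LitStatus Y

litStatus : ∀ {X Y} → (X → Bool) → Literal (X ⊎ Y) → LitStatus Y
litStatus τ (pos (inj₁ x)) with τ x
... | true  = satisfied
... | false = falsified
litStatus τ (neg (inj₁ x)) with τ x
... | true  = falsified
... | false = satisfied
litStatus τ (pos (inj₂ y)) = remains (pos y)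
litStatus τ (neg (inj₂ y)) = remains (neg y)

data ClauseStatus (Y : Set) : Set where
  sat  : ClauseStatus Y
  rest : Clause Y → ClauseStatus Y

restrictClause : ∀ {X Y} → (X → Bool) → Clause (X ⊎ Y) → ClauseStatus Y
restrictClause τ [] = rest []
restrictClause τ (l ∷ C) with restrictClause τ C
... | sat = sat
... | rest C' with litStatus τ l
...   | satisfied = sat
...   | falsified = rest C'
...   | remains l' = rest (l' ∷ C')

restrict : ∀ {X Y} → CNF (X ⊎ Y) → (X → Bool) → CNF Y
restrict [] τ = []
restrict (C ∷ F) τ with restrictClause τ C
... | sat    = restrict F τ
... | rest C' = C' ∷ restrict F τ

EncodesIS : (G : Graph) {m : ℕ} → CNF (Graph.Vertex G ⊎ Fin m) → Set
EncodesIS G {m} F = ∀ (τ : Graph.Vertex G → Bool) →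
  (Satisfiable (restrict F τ) → IsIndependent G τ) ×
  (IsIndependent G τ → Satisfiable (restrict F τ))

{-# OPTIONS --safe #-}
-- Besides the selection variables x_u, the encoding has auxiliary variables s(i,j), meaning
-- "some selected interval ending at j starts at or before i", and c(q), meaning "the unit
-- segment [q-1,q] lies inside a selected interval". Each interval u = [i,j] contributes
--   x_u → s(i,j),  s(i,j) → s(i+1,j),  s(i,j) → c(i+1),  ¬(x_u ∧ c(i)),  ¬(x_u ∧ c(j+1)).
-- The first three clauses force every unit segment of a selected interval to be covered, the
-- last two forbid covering the segments just outside it. Of two distinct intersecting
-- intervals, one has its left end (or, if the left ends agree, its right end) inside the other,
-- so one of them forbids a segment the other covers. Conversely, for an independent selection
-- the intended meanings of s and c satisfy every clause. This uses 5 clauses per interval,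
-- at most 5(n+1)² ≤ 26n² in total.
module Submission where

open import Defs
open import Data.Bool using (Bool; true; false; not; _∧_; _∨_; T)
open import Data.Bool.ListAction using (any; all)
open import Data.Bool.Properties using (T-≡; not-¬; not-injective; ∨-zeroʳ) renaming (_≟_ to _≟ᵇ_)
open import Data.Empty using (⊥)
open import Data.Fin using (Fin; toℕ)
open import Data.Fin.Properties using (toℕ-fromℕ<; +↔⊎; *↔×)
open import Data.List using (List; []; _∷_; length; concatMap; mapMaybe; upTo)
open import Data.List.Properties using (length-++; length-mapMaybe; length-upTo)
open import Data.List.Membership.Propositional using (_∈_; lose)
open import Data.List.Membership.Propositional.Properties using (∈-concatMap⁺; ∈-upTo⁺)
open import Data.List.Relation.Unary.All as All using (All; []; _∷_)
open import Data.List.Relation.Unary.All.Properties using (all⁺; all⁻; concat⁺; concat⁻)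
  renaming (map⁺ to All-map⁺; map⁻ to All-map⁻)
open import Data.List.Relation.Unary.Any as Any using (Any; here; there; any?)
open import Data.List.Relation.Unary.Any.Properties using (any⁺; any⁻; mapMaybe⁺)
  renaming (map⁺ to Any-map⁺)
open import Data.Maybe using (Maybe; just; nothing)
import Data.Maybe.Relation.Unary.Any as MaybeAny
open import Data.Nat
  using (ℕ; suc; _+_; _*_; _^_; _≤_; _<_; _≤′_; ≤′-refl; ≤′-step; s≤s; s≤s⁻¹; z≤n; _≤?_; _<?_)
open import Data.Nat.DivMod using (_mod_; m<n⇒m%n≡m)
open import Data.Nat.Properties
  using (_≟_; ≤-refl; ≤-trans; ≤-reflexive; ≤-irrelevant; <-trans; ≤-<-trans; <-≤-trans; <⇒≤; <⇒≢;
         <-cmp; m≤n⇒m≤1+n; m<n⇒m<1+n; m≤m+n; +-mono-≤; *-monoˡ-≤; ≤⇒≤′; ≤′⇒≤; ^-monoˡ-≤; ^-monoʳ-≤;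
         module ≤-Reasoning)
open import Data.Nat.Tactic.RingSolver using (solve-∀)
open import Data.Product using (Σ; ∃; _×_; _,_)
open import Data.Sum using (_⊎_; inj₁; inj₂; [_,_]; [_,_]′)
open import Data.Sum.Function.Propositional using (_⊎-↔_)
open import Function using (_∘_; _⇔_; _↔_; mk⇔; Equivalence; Inverse)
open import Function.Properties.Inverse using (↔-refl; ↔-trans)
open import Level using (0ℓ)
open import Relation.Binary using (tri<; tri≈; tri>)
open import Relation.Binary.PropositionalEquality using (_≡_; refl; sym; trans; cong; cong₂; subst)
open import Relation.Nullary using (¬_; Dec; yes; does; contradiction)
open import Relation.Nullary.Decidable using (dec-true; dec-false; dec-yes-irr; map′; _×-dec_)
open import Relation.Unary using (Pred; Decidable)

_⊨_ : ∀ {V : Set} → (V → Bool) → Clause V → Set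
ρ ⊨ C = Any (λ l → litVal ρ l ≡ true) C

evalCNF : ∀ {V : Set} → (V → Bool) → CNF V → Bool
evalCNF ρ = all (any (litVal ρ))

satisfies⇔evalCNF : ∀ {V : Set} (ρ : V → Bool) F → Satisfies ρ F ⇔ T (evalCNF ρ F)
satisfies⇔evalCNF ρ F = mk⇔
  (all⁻ _ ∘ All.map (any⁺ _ ∘ Any.map (Equivalence.from T-≡)))
  (All.map (Any.map (Equivalence.to T-≡) ∘ any⁻ _ _) ∘ all⁺ _ F)

module _ {X Y : Set} (τ : X → Bool) (σ : Y → Bool) where

  litStatusValue : LitStatus Y → Bool
  litStatusValue satisfied   = true
  litStatusValue falsified   = false
  litStatusValue (remains l) = litVal σ l

  clauseStatusValue : ClauseStatus Y → Bool
  clauseStatusValue sat      = true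
  clauseStatusValue (rest C) = any (litVal σ) C

  litStatus-value : ∀ l → litStatusValue (litStatus τ l) ≡ litVal [ τ , σ ] l
  litStatus-value (pos (inj₁ x)) with τ x
  ... | true  = refl
  ... | false = refl
  litStatus-value (neg (inj₁ x)) with τ x
  ... | true  = refl
  ... | false = refl
  litStatus-value (pos (inj₂ y)) = refl
  litStatus-value (neg (inj₂ y)) = refl

  restrictClause-value : ∀ C → clauseStatusValue (restrictClause τ C) ≡ any (litVal [ τ , σ ]) C
  restrictClause-value [] = refl
  restrictClause-value (l ∷ C) with restrictClause τ C | restrictClause-value C
  ... | sat     | C-true = trans (sym (∨-zeroʳ _)) (cong (litVal [ τ , σ ] l ∨_) C-true)
  ... | rest C′ | C-val with litStatus τ l | litStatus-value l
  ...   | satisfied  | l-val = cong₂ _∨_ l-val C-val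
  ...   | falsified  | l-val = cong₂ _∨_ l-val C-val
  ...   | remains l′ | l-val = cong₂ _∨_ l-val C-val

  evalCNF-restrict : ∀ F → evalCNF σ (restrict F τ) ≡ evalCNF [ τ , σ ] F
  evalCNF-restrict [] = refl
  evalCNF-restrict (C ∷ F) with restrictClause τ C | restrictClause-value C
  ... | sat     | C-true = cong₂ _∧_ C-true (evalCNF-restrict F)
  ... | rest C′ | C-val  = cong₂ _∧_ C-val (evalCNF-restrict F)

  satisfies-restrict : ∀ F → Satisfies σ (restrict F τ) ⇔ Satisfies [ τ , σ ] F
  satisfies-restrict F = mk⇔
    (from (satisfies⇔evalCNF _ F) ∘ subst T (evalCNF-restrict F) ∘ to (satisfies⇔evalCNF σ _))
    (from (satisfies⇔evalCNF σ _) ∘ subst T (sym (evalCNF-restrict F)) ∘ to (satisfies⇔evalCNF _ F))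
    where open Equivalence

infix 6 _⇒_ _⊼_

_⇒_ : ∀ {V : Set} → V → V → Clause V
a ⇒ b = neg a ∷ pos b ∷ []

_⊼_ : ∀ {V : Set} → V → V → Clause V
a ⊼ b = neg a ∷ neg b ∷ []

module _ {V : Set} {ρ : V → Bool} {a b : V} where

  ⊨⇒⁻ : ρ ⊨ (a ⇒ b) → ρ a ≡ true → ρ b ≡ true
  ⊨⇒⁻ (here ¬a)        a = contradiction (sym ¬a) (not-¬ (sym a))
  ⊨⇒⁻ (there (here b)) _ = b

  ⊨⇒⁺ : (ρ a ≡ true → ρ b ≡ true) → ρ ⊨ (a ⇒ b)
  ⊨⇒⁺ a→b with ρ a in a-val
  ... | true  = there (here (a→b refl))
  ... | false = here (cong not a-val)

  ⊨⊼⁻ : ρ ⊨ (a ⊼ b) → ρ a ≡ true → ρ b ≡ false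
  ⊨⊼⁻ (here ¬a)         a = contradiction (sym ¬a) (not-¬ (sym a))
  ⊨⊼⁻ (there (here ¬b)) _ = not-injective {y = false} ¬b

  ⊨⊼⁺ : (ρ a ≡ true → ρ b ≡ false) → ρ ⊨ (a ⊼ b)
  ⊨⊼⁺ a→¬b with ρ a in a-val
  ... | true  = there (here (cong not (a→¬b refl)))
  ... | false = here (cong not a-val)

witness : ∀ {A : Set} (a? : Dec A) → does a? ≡ true → A
witness (yes a) _ = a

length-concatMap-≤ : ∀ {A B : Set} {f : A → List B} {k} →
  (∀ x → length (f x) ≤ k) → ∀ xs → length (concatMap f xs) ≤ length xs * k
length-concatMap-≤ bound []       = z≤n
length-concatMap-≤ {f = f} bound (x ∷ xs) =
  ≤-trans (≤-reflexive (length-++ (f x)))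
          (+-mono-≤ (bound x) (length-concatMap-≤ {f = f} bound xs))

∈-mapMaybe⁺ : ∀ {A B : Set} {f : A → Maybe B} {x xs y} →
  x ∈ xs → f x ≡ just y → y ∈ mapMaybe f xs
∈-mapMaybe⁺ {f = f} x∈xs fx≡y = mapMaybe⁺ f _
  (Any-map⁺ (lose x∈xs (subst (MaybeAny.Any (_ ≡_)) (sym fx≡y) (MaybeAny.just refl))))

module _ {n : ℕ} where

  Interval-≡ : ∀ {u w : Interval n} → lo u ≡ lo w → hi u ≡ hi w → u ≡ w
  Interval-≡ {[ i , j ]⟨ p , q , r ⟩} {[ .i , .j ]⟨ p′ , q′ , r′ ⟩} refl refl
    rewrite ≤-irrelevant p p′ | ≤-irrelevant q q′ | ≤-irrelevant r r′ = refl

  suffix : (u : Interval n) {k : ℕ} → lo u ≤ k → k < hi u → Interval n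
  suffix u {k} lo≤k k<hi = [ k , hi u ]⟨ ≤-trans (1≤lo u) lo≤k , k<hi , hi≤n u ⟩

  toInterval : ℕ → ℕ → Maybe (Interval n)
  toInterval i j with 1 ≤? i | i <? j | j ≤? n
  ... | yes 1≤i | yes i<j | yes j≤n = just [ i , j ]⟨ 1≤i , i<j , j≤n ⟩
  ... | _       | _       | _       = nothing

  toInterval-lo-hi : ∀ u → toInterval (lo u) (hi u) ≡ just u
  toInterval-lo-hi u
    rewrite dec-yes-irr (1 ≤? lo u) ≤-irrelevant (1≤lo u)
          | dec-yes-irr (lo u <? hi u) ≤-irrelevant (lo<hi u)
          | dec-yes-irr (hi u ≤? n) ≤-irrelevant (hi≤n u) = refl

  intervalsFrom : ℕ → List (Interval n)
  intervalsFrom i = mapMaybe (toInterval i) (upTo (suc n))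

  intervals : List (Interval n)
  intervals = concatMap intervalsFrom (upTo (suc n))

  ∈-intervals : ∀ u → u ∈ intervals
  ∈-intervals u = ∈-concatMap⁺ intervalsFrom (lose (∈-upTo⁺ lo<1+n) hi∈)
    where
    lo<1+n = m<n⇒m<1+n (<-≤-trans (lo<hi u) (hi≤n u))
    hi∈ = ∈-mapMaybe⁺ {f = toInterval (lo u)} (∈-upTo⁺ (s≤s (hi≤n u))) (toInterval-lo-hi u)

  length-intervals : length intervals ≤ suc n * suc n
  length-intervals =
    ≤-trans (length-concatMap-≤ {f = intervalsFrom} length-intervalsFrom (upTo (suc n)))
            (≤-reflexive (cong (_* suc n) (length-upTo (suc n))))
    where
    length-intervalsFrom : ∀ i → length (intervalsFrom i) ≤ suc n
    length-intervalsFrom i = ≤-trans (length-mapMaybe (toInterval i) (upTo (suc n)))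
                                     (≤-reflexive (length-upTo (suc n)))

  ∃-Interval? : ∀ {P : Pred (Interval n) 0ℓ} → Decidable P → Dec (∃ P)
  ∃-Interval? P? = map′ Any.satisfied (λ (u , Pu) → lose (∈-intervals u) Pu) (any? P? intervals)

-- The five clauses of u, with x, started and covered in place of the variables x, s and c.
record Consistent {n : ℕ} (x : Interval n → Bool) (started : ℕ → ℕ → Bool) (covered : ℕ → Bool)
                  (u : Interval n) : Set where
  field
    selected⇒started      : x u ≡ true → started (lo u) (hi u) ≡ true
    started⇒started-suc   : started (lo u) (hi u) ≡ true → started (suc (lo u)) (hi u) ≡ true
    started⇒covered       : started (lo u) (hi u) ≡ true → covered (suc (lo u)) ≡ true
    selected⇒uncovered-lo : x u ≡ true → covered (lo u) ≡ false
    selected⇒uncovered-hi : x u ≡ true → covered (suc (hi u)) ≡ false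

Consistent-cong : ∀ {n x s s′ c c′} (u : Interval n) →
  (∀ {i j} → i < 2 + n → j < 2 + n → s′ i j ≡ s i j) → (∀ {q} → q < 2 + n → c′ q ≡ c q) →
  Consistent x s c u → Consistent x s′ c′ u
Consistent-cong {n} {s = s} {s′} u s′≗s c′≗c cons = record
  { selected⇒started      = trans (s′≗s lo< hi<) ∘ selected⇒started
  ; started⇒started-suc   = trans (s′≗s 1+lo< hi<) ∘ started⇒started-suc ∘ unfold
  ; started⇒covered       = trans (c′≗c 1+lo<) ∘ started⇒covered ∘ unfold
  ; selected⇒uncovered-lo = trans (c′≗c lo<) ∘ selected⇒uncovered-lo
  ; selected⇒uncovered-hi = trans (c′≗c (s≤s (s≤s (hi≤n u)))) ∘ selected⇒uncovered-hi
  }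
  where
  open Consistent cons
  hi< : hi u < 2 + n
  hi< = m<n⇒m<1+n (s≤s (hi≤n u))
  1+lo< : suc (lo u) < 2 + n
  1+lo< = ≤-<-trans (lo<hi u) hi<
  lo< : lo u < 2 + n
  lo< = <-trans (lo<hi u) hi<
  unfold : s′ (lo u) (hi u) ≡ true → s (lo u) (hi u) ≡ true
  unfold = trans (sym (s′≗s lo< hi<))

module _ {n : ℕ} {x : Interval n → Bool} {started : ℕ → ℕ → Bool} {covered : ℕ → Bool}
         (consistent : ∀ u → Consistent x started covered u) where

  private module C u = Consistent (consistent u)

  started-suffix : ∀ {u k} → x u ≡ true → lo u ≤′ k → k < hi u → started k (hi u) ≡ true
  started-suffix {u} xu ≤′-refl          _    = C.selected⇒started u xu
  started-suffix {u} xu (≤′-step lo≤′k) k<hi =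
    C.started⇒started-suc (suffix u (≤′⇒≤ lo≤′k) (<⇒≤ k<hi))
                          (started-suffix xu lo≤′k (<⇒≤ k<hi))

  covered-inside : ∀ {u q} → x u ≡ true → lo u < q → q ≤ hi u → covered q ≡ true
  covered-inside {u} xu (s≤s lo≤k) k<hi =
    C.started⇒covered (suffix u lo≤k k<hi) (started-suffix xu (≤⇒≤′ lo≤k) k<hi)

  lo-inside⇒⊥ : ∀ {u w} → x u ≡ true → x w ≡ true → lo u < lo w → lo w ≤ hi u → ⊥
  lo-inside⇒⊥ {w = w} xu xw lu<lw lw≤hu =
    not-¬ (covered-inside xu lu<lw lw≤hu) (C.selected⇒uncovered-lo w xw)

  hi-inside⇒⊥ : ∀ {u w} → x u ≡ true → x w ≡ true → lo w ≤ hi u → hi u < hi w → ⊥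
  hi-inside⇒⊥ {u} xu xw lw≤hu hu<hw =
    not-¬ (covered-inside xw (s≤s lw≤hu) hu<hw) (C.selected⇒uncovered-hi u xu)

  consistent⇒independent : IsIndependent (𝓘 n) x
  consistent⇒independent u w xu xw (u≢w , lu≤hw , lw≤hu) with <-cmp (lo u) (lo w)
  ... | tri< lu<lw _ _ = lo-inside⇒⊥ xu xw lu<lw lw≤hu
  ... | tri> _ _ lw<lu = lo-inside⇒⊥ xw xu lw<lu lu≤hw
  ... | tri≈ _ lu≡lw _ with <-cmp (hi u) (hi w)
  ...   | tri< hu<hw _ _ = hi-inside⇒⊥ xu xw lw≤hu hu<hw
  ...   | tri> _ _ hw<hu = hi-inside⇒⊥ xw xu lu≤hw hw<hu
  ...   | tri≈ _ hu≡hw _ = u≢w (Interval-≡ lu≡lw hu≡hw)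

module _ {n : ℕ} (x : Interval n → Bool) where

  StartedBy : ℕ → ℕ → Set
  StartedBy i j = ∃ λ w → x w ≡ true × lo w ≤ i × hi w ≡ j

  Covered : ℕ → Set
  Covered q = ∃ λ w → x w ≡ true × lo w < q × q ≤ hi w

  startedBy? : ∀ i j → Dec (StartedBy i j)
  startedBy? i j = ∃-Interval? λ w → x w ≟ᵇ true ×-dec lo w ≤? i ×-dec hi w ≟ j

  covered? : ∀ q → Dec (Covered q)
  covered? q = ∃-Interval? λ w → x w ≟ᵇ true ×-dec lo w <? q ×-dec q ≤? hi w

  independent⇒consistent : IsIndependent (𝓘 n) x →
    ∀ u → Consistent x (λ i j → does (startedBy? i j)) (does ∘ covered?) u
  independent⇒consistent independent u = record
    { selected⇒started      = λ xu → dec-true (startedBy? _ _) (u , xu , ≤-refl , refl)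
    ; started⇒started-suc   = dec-true (startedBy? _ _) ∘ started-suc ∘ witness (startedBy? _ _)
    ; started⇒covered       = dec-true (covered? _) ∘ started⇒Covered ∘ witness (startedBy? _ _)
    ; selected⇒uncovered-lo = λ xu → dec-false (covered? _) (uncovered-lo xu)
    ; selected⇒uncovered-hi = λ xu → dec-false (covered? _) (uncovered-hi xu)
    }
    where
    started-suc : StartedBy (lo u) (hi u) → StartedBy (suc (lo u)) (hi u)
    started-suc (w , xw , lw≤lu , hw≡hu) = w , xw , m≤n⇒m≤1+n lw≤lu , hw≡hu

    started⇒Covered : StartedBy (lo u) (hi u) → Covered (suc (lo u))
    started⇒Covered (w , xw , lw≤lu , hw≡hu) =
      w , xw , s≤s lw≤lu , subst (suc (lo u) ≤_) (sym hw≡hu) (lo<hi u)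

    uncovered-lo : x u ≡ true → ¬ Covered (lo u)
    uncovered-lo xu (w , xw , lw<lu , lu≤hw) =
      independent u w xu xw (<⇒≢ lw<lu ∘ cong lo ∘ sym , lu≤hw , <⇒≤ (<-trans lw<lu (lo<hi u)))

    uncovered-hi : x u ≡ true → ¬ Covered (suc (hi u))
    uncovered-hi xu (w , xw , s≤s lw≤hu , hu<hw) =
      independent u w xu xw (<⇒≢ hu<hw ∘ cong hi , <⇒≤ (<-trans (lo<hi u) hu<hw) , lw≤hu)

module Encoding (n : ℕ) where

  N : ℕ
  N = 2 + n

  Var : Set
  Var = Interval n ⊎ Fin (N * N + N)

  auxIndex : Fin (N * N + N) ↔ (Fin N × Fin N ⊎ Fin N)
  auxIndex = ↔-trans +↔⊎ (*↔× ⊎-↔ ↔-refl)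

  -- Indices are reduced mod N; every index occurring in a clause is at most n + 1 < N.
  startedVar : ℕ → ℕ → Var
  startedVar i j = inj₂ (Inverse.from auxIndex (inj₁ (i mod N , j mod N)))

  coveredVar : ℕ → Var
  coveredVar q = inj₂ (Inverse.from auxIndex (inj₂ (q mod N)))

  clausesFor : Interval n → CNF Var
  clausesFor u = inj₁ u ⇒ startedVar (lo u) (hi u)
               ∷ startedVar (lo u) (hi u) ⇒ startedVar (suc (lo u)) (hi u)
               ∷ startedVar (lo u) (hi u) ⇒ coveredVar (suc (lo u))
               ∷ inj₁ u ⊼ coveredVar (lo u)
               ∷ inj₁ u ⊼ coveredVar (suc (hi u))
               ∷ []

  intervalCNF : CNF Var
  intervalCNF = concatMap clausesFor intervals

  length-intervalCNF : length intervalCNF ≤ suc n * suc n * 5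
  length-intervalCNF = ≤-trans (length-concatMap-≤ {f = clausesFor} (λ _ → ≤-refl) intervals)
                               (*-monoˡ-≤ 5 (length-intervals {n}))

  VarsConsistent : (Var → Bool) → Interval n → Set
  VarsConsistent ρ = Consistent (ρ ∘ inj₁) (λ i j → ρ (startedVar i j)) (ρ ∘ coveredVar)

  clausesFor⇔ : ∀ ρ u → Satisfies ρ (clausesFor u) ⇔ VarsConsistent ρ u
  clausesFor⇔ ρ u = mk⇔
    (λ { (c₁ ∷ c₂ ∷ c₃ ∷ c₄ ∷ c₅ ∷ []) → record
         { selected⇒started      = ⊨⇒⁻ c₁
         ; started⇒started-suc   = ⊨⇒⁻ c₂
         ; started⇒covered       = ⊨⇒⁻ c₃
         ; selected⇒uncovered-lo = ⊨⊼⁻ c₄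
         ; selected⇒uncovered-hi = ⊨⊼⁻ c₅
         } })
    (λ cons → let open Consistent cons in
       ⊨⇒⁺ selected⇒started ∷ ⊨⇒⁺ started⇒started-suc ∷ ⊨⇒⁺ started⇒covered
       ∷ ⊨⊼⁺ selected⇒uncovered-lo ∷ ⊨⊼⁺ selected⇒uncovered-hi ∷ [])

  intervalCNF⇔ : ∀ ρ → Satisfies ρ intervalCNF ⇔ (∀ u → VarsConsistent ρ u)
  intervalCNF⇔ ρ = mk⇔
    (λ ρ⊨F u → to (clausesFor⇔ ρ u) (All.lookup (All-map⁻ (concat⁻ ρ⊨F)) (∈-intervals u)))
    (λ cons → concat⁺ (All-map⁺ (All.universal (λ u → from (clausesFor⇔ ρ u) (cons u)) intervals)))
    where open Equivalence

  auxAssignment : (ℕ → ℕ → Bool) → (ℕ → Bool) → Fin N × Fin N ⊎ Fin N → Bool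
  auxAssignment s c = [ (λ (a , b) → s (toℕ a) (toℕ b)) , c ∘ toℕ ]

  assignment : (ℕ → ℕ → Bool) → (ℕ → Bool) → Fin (N * N + N) → Bool
  assignment s c = auxAssignment s c ∘ Inverse.to auxIndex

  toℕ-mod : ∀ {i} → i < N → toℕ (i mod N) ≡ i
  toℕ-mod i<N = trans (toℕ-fromℕ< _) (m<n⇒m%n≡m i<N)

  assignment-consistent : ∀ {x s c} → (∀ u → Consistent x s c u) →
    ∀ u → VarsConsistent [ x , assignment s c ]′ u
  assignment-consistent {x} {s} {c} cons u = Consistent-cong u started≗ covered≗ (cons u)
    where
    ρ = [ x , assignment s c ]′

    started≗ : ∀ {i j} → i < N → j < N → ρ (startedVar i j) ≡ s i j
    started≗ i<N j<N =
      trans (cong (auxAssignment s c) (Inverse.strictlyInverseˡ auxIndex (inj₁ _)))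
            (cong₂ s (toℕ-mod i<N) (toℕ-mod j<N))

    covered≗ : ∀ {q} → q < N → ρ (coveredVar q) ≡ c q
    covered≗ q<N =
      trans (cong (auxAssignment s c) (Inverse.strictlyInverseˡ auxIndex (inj₂ _)))
            (cong c (toℕ-mod q<N))

  encodes : EncodesIS (𝓘 n) intervalCNF
  encodes x = sound , complete
    where
    open Equivalence

    sound : Satisfiable (restrict intervalCNF x) → IsIndependent (𝓘 n) x
    sound (σ , σ⊨F|x) =
      consistent⇒independent (to (intervalCNF⇔ _) (to (satisfies-restrict x σ intervalCNF) σ⊨F|x))

    complete : IsIndependent (𝓘 n) x → Satisfiable (restrict intervalCNF x)
    complete independent = σ , from (satisfies-restrict x σ intervalCNF)
      (from (intervalCNF⇔ _) (assignment-consistent (independent⇒consistent x independent)))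
      where σ = assignment (λ i j → does (startedBy? x i j)) (does ∘ covered? x)

[1+n]²*5≤26n² : ∀ {n} → 1 ≤ n → suc n * suc n * 5 ≤ 26 * (n * n)
[1+n]²*5≤26n² {suc k} _ = begin
  (2 + k) * (2 + k) * 5                                 ≤⟨ m≤m+n _ _ ⟩
  (2 + k) * (2 + k) * 5 + (21 * (k * k) + 32 * k + 6)   ≡⟨ expand k ⟩
  26 * ((1 + k) * (1 + k))                              ∎
  where
  open ≤-Reasoning
  expand : ∀ k →
    (2 + k) * (2 + k) * 5 + (21 * (k * k) + 32 * k + 6) ≡ 26 * ((1 + k) * (1 + k))
  expand = solve-∀

theorem21 : ∀ (n : ℕ) → 2 ≤ n →
    Σ ℕ λ m → Σ (CNF (Interval n ⊎ Fin m)) λ F →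
      EncodesIS (𝓘 n) F × (2 ^ length F ≤ n ^ (26 * (n * n)))
theorem21 n 2≤n = _ , intervalCNF , encodes , (begin
  2 ^ length intervalCNF   ≤⟨ ^-monoʳ-≤ 2 (≤-trans length-intervalCNF clause-count) ⟩
  2 ^ (26 * (n * n))       ≤⟨ ^-monoˡ-≤ (26 * (n * n)) 2≤n ⟩
  n ^ (26 * (n * n))       ∎)
  where
  open Encoding n
  open ≤-Reasoning
  clause-count = [1+n]²*5≤26n² (<⇒≤ 2≤n)
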